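{- Let $s\in\mathbb{N}$ and $\beta\in\mathbb{R}^+$, and let $\mathcal{G}$ be an infinite class of $(s,\beta)$-expanders. Then the reduced bandwidth $\widetilde{\mathrm{bw}}$ is unbounded on $\mathcal{G}$.
   Context: A graph $G$ is an $(s,\beta)$-expander if $G$ contains no $K_{s,s}$ subgraph and for every $S\subseteq V(G)$ with $|S|\le |V(G)|/2$ we have $|N_G(S)|\ge\beta|S|$, where $N_G(S)$ is the set of vertices outside $S$ with a neighbour in $S$. A trigraph is a triple $(V,E,R)$ with $V$ finite and $E,R$ disjoint subsets of $\binom V2$ (black and red edges); its red graph is $(V,R)$. For distinct $u,v$, $G/u,v$ replaces $u,v$ by a new vertex $w$, keeping other pairs unchanged, where for each other vertex $x$: $wx$ is black iff $ux,vx$ are both black, a non-edge iff neither $ux$ nor $vx$ is an edge, and red otherwise. A reduction sequence of an $n$-vertex trigraph $G_n$ is $G_n,\dots,G_1$ with $G_{i-1}=G_i/u,v$ and $|V(G_1)|=1$; a graph is the trigraph with no red edges. The reduced bandwidth $\widetilde{\mathrm{bw}}(G)$ is the minimum $k\in\mathbb{N}$ such that some reduction sequence of $G$ has all red graphs of bandwidth at most $k$ (bandwidth: minimum $k$ such that some vertex ordering $v_1,\dots,v_n$ has $|i-j|\le k$ for every edge $v_iv_j$).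
   Formalization: The expansion constant β of the $(s,\beta)$-expanders ranges over the positive rationals rather than the positive reals. -}

module Defs where

open import Data.Nat using (ℕ; zero; suc; _+_; _*_; _≤_; _<_; ∣_-_∣)
open import Data.Bool using (Bool; true; false; _∧_; _∨_; not; if_then_else_)
open import Data.Fin using (Fin; zero; suc; toℕ; punchIn; _≟_)
open import Data.Fin.Subset using (Subset; ∣_∣)
open import Data.Fin.Permutation using (Permutation′; _⟨$⟩ʳ_)
open import Data.Vec using (Vec; lookup; tabulate)
open import Data.Product using (Σ; _×_; _,_; ∃)
open import Relation.Binary.PropositionalEquality using (_≡_; _≢_)
open import Relation.Nullary using (¬_; yes; no)
open import Function.Definitions using (Injective)

record Graph (n : ℕ) : Set where
  field
    adj     : Fin n → Fin n → Bool
    sym     : ∀ i j → adj i j ≡ adj j i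
    irrefl  : ∀ i → adj i i ≡ false
open Graph public

-- G contains K_{s,s} as a subgraph: two injective maps A,B : Fin s → V
-- with every A i adjacent to every B j (this forces the images disjoint,
-- as adjacency is irreflexive).
HasKss : ∀ {n} → ℕ → Graph n → Set
HasKss {n} s G =
  Σ (Fin s → Fin n) λ A → Σ (Fin s → Fin n) λ B →
    Injective _≡_ _≡_ A × Injective _≡_ _≡_ B ×
    (∀ i j → adj G (A i) (B j) ≡ true)

anyFin : ∀ {n} → (Fin n → Bool) → Bool
anyFin {zero}  f = false
anyFin {suc n} f = f zero ∨ anyFin (λ i → f (suc i))

nbhd : ∀ {n} → Graph n → Subset n → Subset n
nbhd G S = tabulate λ x → not (lookup S x) ∧ anyFin (λ y → lookup S y ∧ adj G y x)

-- (s,β)-expander with β = p / q (p, q positive naturals):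
-- no K_{s,s}, and for every S with |S| ≤ n/2, |N(S)| ≥ (p/q)|S|.
IsExpander : ∀ {n} → (s p q : ℕ) → Graph n → Set
IsExpander {n} s p q G =
  ¬ HasKss s G ×
  (∀ (S : Subset n) → 2 * ∣ S ∣ ≤ n → p * ∣ S ∣ ≤ q * ∣ nbhd G S ∣)

data Colour : Set where
  none black red : Colour

Trigraph : ℕ → Set
Trigraph n = Fin n → Fin n → Colour

graph→trigraph : ∀ {n} → Graph n → Trigraph n
graph→trigraph G i j = if adj G i j then black else none

merge : Colour → Colour → Colour
merge black black = black
merge none  none  = none
merge _     _     = red

-- Contraction T / u,v (u ≢ v).  The vertex set of the result is
-- V(T) ∖ {v} (identified with Fin n via punchIn v), and the new vertex w
-- occupies the place of u.
contract : ∀ {n} → Trigraph (suc n) → (u v : Fin (suc n)) → u ≢ v → Trigraph n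
contract T u v _ a b with punchIn v a ≟ u | punchIn v b ≟ u
... | yes _ | _     = merge (T u (punchIn v b)) (T v (punchIn v b))
... | no _  | yes _ = merge (T u (punchIn v a)) (T v (punchIn v a))
... | no _  | no _  = T (punchIn v a) (punchIn v b)

RedBandwidth≤ : ∀ {n} → ℕ → Trigraph n → Set
RedBandwidth≤ {n} k T =
  Σ (Permutation′ n) λ pos →
    ∀ i j → i ≢ j → T i j ≡ red → ∣ toℕ (pos ⟨$⟩ʳ i) - toℕ (pos ⟨$⟩ʳ j) ∣ ≤ k

data Reduction≤ (k : ℕ) : ∀ {n} → Trigraph (suc n) → Set where
  done : (T : Trigraph 1) → RedBandwidth≤ k T → Reduction≤ k T
  step : ∀ {n} (T : Trigraph (suc (suc n))) (u v : Fin (suc (suc n)))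
         (u≢v : u ≢ v) → RedBandwidth≤ k T →
         Reduction≤ k (contract T u v u≢v) → Reduction≤ k T

RedBW≤ : ∀ {n} → ℕ → Graph (suc n) → Set
RedBW≤ k G = Reduction≤ k (graph→trigraph G)

{-# OPTIONS --safe #-}

-- Follow a reduction sequence whose red graphs have bandwidth at most k up to the first
-- trigraph in which some part (the set of vertices of G merged into one vertex) has more than
-- E ≈ N/D vertices; then every part has at most 2E vertices, and every non-red pair of distinct
-- parts is homogeneous in G. Order the parts along the bandwidth ordering and let S be the union
-- of the big parts (at least L_{i+1} vertices) among the first j positions. A neighbour of S
-- outside S lies in a big part red to S, hence among the next k positions; or in a part of
-- middle size [L_i, L_{i+1}); or in a tiny part red to a part of S, and each part has at most
-- 2k+1 red neighbours; or in a part black to a part of S, and these contain fewer than s vertices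
-- per part of S because a black pair of parts is complete bipartite and G has no K_{s,s}.
-- With L_{i+1} = 3q((2k+1)L_i + s), a scale i < J holding few middle-size vertices (pigeonhole)
-- and j chosen so that |S| is about N/2, each kind of neighbour accounts for less than |S|/(3q)
-- vertices, contradicting |N(S)| ≥ (p/q)|S|.

module Submission where

open import Defs hiding (sym)

open import Data.Bool using (Bool; true; false; not; _∧_; _∨_; if_then_else_)
import Data.Bool as Bool
open import Data.Bool.Properties using (∧-conicalˡ; ∧-conicalʳ)
open import Data.Empty using (⊥; ⊥-elim)
open import Data.Fin using (Fin; zero; suc; toℕ; fromℕ<; _≟_; punchIn; punchOut)
open import Data.Fin.Permutation using (_⟨$⟩ʳ_)
open import Data.Fin.Properties
  using (any?; injective⇒≤; suc-injective; toℕ-injective; toℕ-fromℕ<; toℕ<n;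
         punchIn-punchOut; punchIn-injective)
open import Data.Fin.Subset using (Subset; ∣_∣)
open import Data.Nat using (ℕ; zero; suc; _+_; _*_; _∸_; _≤_; _<_; _≤′_; ≤′-refl; ≤′-step;
                            z≤n; s≤s; s≤s⁻¹; >-nonZero)
import Data.Nat as ℕ
open import Data.Nat.Properties hiding (_≟_; suc-injective)
open import Algebra.Properties.Semiring.Sum +-*-semiring
  using (sum; sum-syntax; sum-cong-≗; ∑-comm; ∑-distrib-+; *-distribˡ-sum; sum-replicate-zero)
open import Data.Nat.Tactic.RingSolver using (solve-∀)
open import Data.Product using (Σ; ∃; _×_; _,_; proj₁; proj₂)
open import Data.Sum using (_⊎_; inj₁; inj₂; [_,_])
open import Data.Vec using (tabulate; lookup)
import Data.Vec.Functional as Vector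
open import Data.Vec.Properties using (lookup∘tabulate)
open import Function using (_∘_; id; case_of_)
open import Function.Bundles using (Injection)
open import Function.Definitions using (Injective)
open import Function.Properties.Inverse using (↔⇒↣)
open import Relation.Binary.PropositionalEquality
  using (_≡_; _≢_; refl; sym; trans; cong; cong₂; subst; subst₂; module ≡-Reasoning)
open import Relation.Nullary using (Dec; yes; no; does; ¬_; ¬?; _⊎-dec_; _×-dec_)
open import Relation.Unary using (Decidable)

private
  variable
    n m r : ℕ

-- Counting over Fin

𝟙 : Bool → ℕ
𝟙 true  = 1
𝟙 false = 0

count : {P : Fin n → Set} → Decidable P → ℕ
count {n} P? = ∑[ x < n ] 𝟙 (does (P? x))

∑-mono-≤ : {g h : Fin n → ℕ} → (∀ a → g a ≤ h a) → sum g ≤ sum h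
∑-mono-≤ {zero}  _   = z≤n
∑-mono-≤ {suc n} g≤h = +-mono-≤ (g≤h zero) (∑-mono-≤ (g≤h ∘ suc))

∑-δ : (b : Fin n) (g : Fin n → ℕ) → ∑[ a < n ] (𝟙 (does (b ≟ a)) * g a) ≡ g b
∑-δ {suc n} zero g =
  trans (cong₂ _+_ (*-identityˡ (g zero)) (sum-replicate-zero n)) (+-identityʳ (g zero))
∑-δ {suc n} (suc b) g = ∑-δ b (g ∘ suc)

𝟙-∨ : ∀ a b → 𝟙 (a ∨ b) ≤ 𝟙 a + 𝟙 b
𝟙-∨ true  _ = s≤s z≤n
𝟙-∨ false _ = ≤-refl

𝟙≤1 : ∀ b → 𝟙 b ≤ 1
𝟙≤1 true  = ≤-refl
𝟙≤1 false = z≤n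

𝟙-does-mono : {A B : Set} → (A → B) → (a? : Dec A) (b? : Dec B) →
              𝟙 (does a?) ≤ 𝟙 (does b?)
𝟙-does-mono A→B (yes a) (no ¬b) = ⊥-elim (¬b (A→B a))
𝟙-does-mono A→B (yes _) (yes _) = ≤-refl
𝟙-does-mono A→B (no _)  _       = z≤n

count-mono : {P Q : Fin n → Set} (P? : Decidable P) (Q? : Decidable Q) →
             (∀ {x} → P x → Q x) → count P? ≤ count Q?
count-mono P? Q? P⊆Q = ∑-mono-≤ λ x → 𝟙-does-mono P⊆Q (P? x) (Q? x)

count≤n : {P : Fin n → Set} (P? : Decidable P) → count P? ≤ n
count≤n {zero}  P? = z≤n
count≤n {suc n} P? = +-mono-≤ (𝟙≤1 (does (P? zero))) (count≤n (P? ∘ suc))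

count-none : {P : Fin n → Set} (P? : Decidable P) → (∀ x → ¬ P x) → count P? ≡ 0
count-none {zero}  P? ¬P = refl
count-none {suc n} P? ¬P with P? zero
... | yes p = ⊥-elim (¬P zero p)
... | no  _ = count-none (P? ∘ suc) (¬P ∘ suc)

count-all : {P : Fin n → Set} (P? : Decidable P) → (∀ x → P x) → count P? ≡ n
count-all {zero}  P? ∀P = refl
count-all {suc n} P? ∀P with P? zero
... | yes _  = cong suc (count-all (P? ∘ suc) (∀P ∘ suc))
... | no ¬P0 = ⊥-elim (¬P0 (∀P zero))

count-⊎ : {P Q : Fin n → Set} (P? : Decidable P) (Q? : Decidable Q) →
          count (λ x → P? x ⊎-dec Q? x) ≤ count P? + count Q?
count-⊎ {n} P? Q? = begin
  count (λ x → P? x ⊎-dec Q? x)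
    ≤⟨ ∑-mono-≤ (λ x → 𝟙-∨ (does (P? x)) (does (Q? x))) ⟩
  ∑[ x < n ] (𝟙 (does (P? x)) + 𝟙 (does (Q? x)))
    ≡⟨ ∑-distrib-+ (𝟙 ∘ does ∘ P?) (𝟙 ∘ does ∘ Q?) ⟩
  count P? + count Q?  ∎
  where open ≤-Reasoning

count-disjoint-⊎ : {P Q : Fin n → Set} (P? : Decidable P) (Q? : Decidable Q) →
                   (∀ {x} → P x → ¬ Q x) → count P? + count Q? ≤ count (λ x → P? x ⊎-dec Q? x)
count-disjoint-⊎ {P = P} {Q} P? Q? P∩Q=∅ = begin
  count P? + count Q?  ≡⟨ ∑-distrib-+ (𝟙 ∘ does ∘ P?) (𝟙 ∘ does ∘ Q?) ⟨
  _                    ≤⟨ ∑-mono-≤ (λ x → 𝟙-disjoint (P? x) (Q? x)) ⟩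
  count (λ x → P? x ⊎-dec Q? x)  ∎
  where
  open ≤-Reasoning
  𝟙-disjoint : ∀ {x} (a? : Dec (P x)) (b? : Dec (Q x)) →
               𝟙 (does a?) + 𝟙 (does b?) ≤ 𝟙 (does (a? ⊎-dec b?))
  𝟙-disjoint (yes a) (yes b) = ⊥-elim (P∩Q=∅ a b)
  𝟙-disjoint (yes _) (no _)  = ≤-refl
  𝟙-disjoint (no _)  _       = ≤-refl

𝟙-any≤count : {P : Fin n → Set} (P? : Decidable P) → 𝟙 (does (any? P?)) ≤ count P?
𝟙-any≤count {zero}  P? = z≤n
𝟙-any≤count {suc n} P? =
  ≤-trans (𝟙-∨ (does (P? zero)) _) (+-monoʳ-≤ _ (𝟙-any≤count (P? ∘ suc)))

count-∃ : {Q : Fin m → Fin n → Set} (Q? : ∀ a → Decidable (Q a)) →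
          count (λ x → any? (λ a → Q? a x)) ≤ ∑[ a < m ] count (Q? a)
count-∃ {m} {n} Q? = begin
  count (λ x → any? (λ a → Q? a x))        ≤⟨ ∑-mono-≤ (λ x → 𝟙-any≤count (λ a → Q? a x)) ⟩
  ∑[ x < n ] ∑[ a < m ] 𝟙 (does (Q? a x))  ≡⟨ ∑-comm (λ x a → 𝟙 (does (Q? a x))) ⟩
  ∑[ a < m ] count (Q? a)                  ∎
  where open ≤-Reasoning

fibre-size : (Fin n → Fin m) → Fin m → ℕ
fibre-size f a = count (λ x → f x ≟ a)

count-∘ : {φ : Fin m → Set} (φ? : Decidable φ) (f : Fin n → Fin m) →
          count (φ? ∘ f) ≡ ∑[ a < m ] (𝟙 (does (φ? a)) * fibre-size f a)
count-∘ {m} {n} φ? f = begin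
  ∑[ x < n ] 𝟙 (does (φ? (f x)))
    ≡⟨ sum-cong-≗ (λ x → ∑-δ (f x) (𝟙 ∘ does ∘ φ?)) ⟨
  ∑[ x < n ] ∑[ a < m ] (𝟙 (does (f x ≟ a)) * 𝟙 (does (φ? a)))
    ≡⟨ ∑-comm (λ x a → 𝟙 (does (f x ≟ a)) * 𝟙 (does (φ? a))) ⟩
  ∑[ a < m ] ∑[ x < n ] (𝟙 (does (f x ≟ a)) * 𝟙 (does (φ? a)))
    ≡⟨ sum-cong-≗ (λ a → sum-cong-≗ (λ x → *-comm (𝟙 (does (f x ≟ a))) _)) ⟩
  ∑[ a < m ] ∑[ x < n ] (𝟙 (does (φ? a)) * 𝟙 (does (f x ≟ a)))
    ≡⟨ sum-cong-≗ (λ a → *-distribˡ-sum (𝟙 (does (φ? a))) (λ x → 𝟙 (does (f x ≟ a)))) ⟨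
  ∑[ a < m ] (𝟙 (does (φ? a)) * fibre-size f a)  ∎
  where open ≡-Reasoning

count-const-× : {A : Set} {Q : Fin n → Set} (a? : Dec A) (Q? : Decidable Q) →
                count (λ x → a? ×-dec Q? x) ≡ 𝟙 (does a?) * count Q?
count-const-× (yes _) Q? = sym (+-identityʳ (count Q?))
count-const-× {n} (no _)  Q? = sum-replicate-zero n

module _ {φ : Fin m → Set} (φ? : Decidable φ) (h : Fin m → ℕ) (c : ℕ) where

  ∑-𝟙*-≤ : (∀ a → φ a → h a ≤ c) → ∑[ a < m ] (𝟙 (does (φ? a)) * h a) ≤ c * count φ?
  ∑-𝟙*-≤ h≤c = begin
    ∑[ a < m ] (𝟙 (does (φ? a)) * h a)  ≤⟨ ∑-mono-≤ (λ a → pointwise a (φ? a)) ⟩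
    ∑[ a < m ] (c * 𝟙 (does (φ? a)))    ≡⟨ *-distribˡ-sum c (𝟙 ∘ does ∘ φ?) ⟨
    c * count φ?                        ∎
    where
    open ≤-Reasoning
    pointwise : ∀ a (d : Dec (φ a)) → 𝟙 (does d) * h a ≤ c * 𝟙 (does d)
    pointwise a (yes φa) =
      subst₂ _≤_ (sym (+-identityʳ (h a))) (sym (*-identityʳ c)) (h≤c a φa)
    pointwise a (no _)   = z≤n

  ∑-𝟙*-≥ : (∀ a → φ a → c ≤ h a) → c * count φ? ≤ ∑[ a < m ] (𝟙 (does (φ? a)) * h a)
  ∑-𝟙*-≥ c≤h = begin
    c * count φ?                        ≡⟨ *-distribˡ-sum c (𝟙 ∘ does ∘ φ?) ⟩
    ∑[ a < m ] (c * 𝟙 (does (φ? a)))    ≤⟨ ∑-mono-≤ (λ a → pointwise a (φ? a)) ⟩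
    ∑[ a < m ] (𝟙 (does (φ? a)) * h a)  ∎
    where
    open ≤-Reasoning
    pointwise : ∀ a (d : Dec (φ a)) → c * 𝟙 (does d) ≤ 𝟙 (does d) * h a
    pointwise a (yes φa) =
      subst₂ _≤_ (sym (*-identityʳ c)) (sym (+-identityʳ (h a))) (c≤h a φa)
    pointwise a (no _)   = ≤-reflexive (*-zeroʳ c)

count-∘-≤ : {φ : Fin m → Set} (φ? : Decidable φ) (f : Fin n → Fin m) {c : ℕ} →
            (∀ a → φ a → fibre-size f a ≤ c) → count (φ? ∘ f) ≤ c * count φ?
count-∘-≤ φ? f {c} ≤c =
  ≤-trans (≤-reflexive (count-∘ φ? f)) (∑-𝟙*-≤ φ? (fibre-size f) c ≤c)

count-∘-≥ : {φ : Fin m → Set} (φ? : Decidable φ) (f : Fin n → Fin m) {c : ℕ} →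
            (∀ a → φ a → c ≤ fibre-size f a) → c * count φ? ≤ count (φ? ∘ f)
count-∘-≥ φ? f {c} c≤ =
  ≤-trans (∑-𝟙*-≥ φ? (fibre-size f) c c≤) (≤-reflexive (sym (count-∘ φ? f)))

extract : {P : Fin n → Set} (P? : Decidable P) {s : ℕ} → s ≤ count P? →
          Σ (Fin s → Fin n) λ A → Injective _≡_ _≡_ A × (∀ i → P (A i))
extract {zero}  P? {zero} _ = (λ ()) , (λ { {()} }) , (λ ())
extract {suc n} P? s≤ with P? zero
... | no _ = let A , A-inj , PA = extract (P? ∘ suc) s≤ in
             suc ∘ A , A-inj ∘ suc-injective , PA
extract {suc n} P? {zero}  s≤ | yes _ = (λ ()) , (λ { {()} }) , (λ ())
extract {suc n} P? {suc s} s≤ | yes P0 =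
  let A , A-inj , PA = extract (P? ∘ suc) (s≤s⁻¹ s≤) in
  (zero Vector.∷ suc ∘ A) , cons-injective A-inj , λ { zero → P0 ; (suc i) → PA i }
  where
  cons-injective : ∀ {A : Fin s → Fin n} → Injective _≡_ _≡_ A →
                   Injective _≡_ _≡_ (zero Vector.∷ suc ∘ A)
  cons-injective A-inj {zero}  {zero}  _  = refl
  cons-injective A-inj {suc i} {suc j} eq = cong suc (A-inj (suc-injective eq))
  cons-injective A-inj {zero}  {suc _} ()
  cons-injective A-inj {suc _} {zero}  ()

count-≤-injection : {P : Fin n → Set} (P? : Decidable P) (g : ∀ x → P x → Fin r) →
                    (∀ {x y} (px : P x) (py : P y) → g x px ≡ g y py → x ≡ y) → count P? ≤ r
count-≤-injection P? g g-inj =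
  let A , A-inj , PA = extract P? ≤-refl in
  injective⇒≤ (λ eq → A-inj (g-inj (PA _) (PA _) eq))

count-interval : {P : Fin n → Set} (P? : Decidable P) (p : Fin n → ℕ) → Injective _≡_ _≡_ p →
                 (lo w : ℕ) → (∀ {x} → P x → lo ≤ p x × p x < lo + w) → count P? ≤ w
count-interval {P = P} P? p p-inj lo w in-range = count-≤-injection P? offset offset-injective
  where
  offset< : ∀ {x} → P x → p x ∸ lo < w
  offset< Px = let lo≤ , <lo+w = in-range Px in
               subst (p _ ∸ lo <_) (m+n∸m≡n lo w) (∸-monoˡ-< <lo+w lo≤)
  offset : ∀ x → P x → Fin w
  offset x Px = fromℕ< (offset< Px)
  offset-injective : ∀ {x y} (Px : P x) (Py : P y) → offset x Px ≡ offset y Py → x ≡ y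
  offset-injective Px Py eq = p-inj (∸-cancelʳ-≡ (proj₁ (in-range Px)) (proj₁ (in-range Py))
    (trans (sym (toℕ-fromℕ< (offset< Px))) (trans (cong toℕ eq) (toℕ-fromℕ< (offset< Py)))))

crossing : (a : ℕ → ℕ) {x : ℕ} → a 0 ≤ x → ∀ t → x < a t →
           ∃ λ j → a j ≤ x × x < a (suc j)
crossing a a0≤x zero        x<a0   = ⊥-elim (<⇒≱ x<a0 a0≤x)
crossing a {x} a0≤x (suc t) x<at+1 with x <? a t
... | yes x<at = crossing a a0≤x t x<at
... | no  x≮at = t , ≮⇒≥ x≮at , x<at+1

≤-step-mono : (a : ℕ → ℕ) → (∀ i → a i ≤ a (suc i)) → ∀ {i j} → i ≤ j → a i ≤ a j
≤-step-mono a a≤a∘suc i≤j = go (≤⇒≤′ i≤j)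
  where
  go : ∀ {i j} → i ≤′ j → a i ≤ a j
  go ≤′-refl       = ≤-refl
  go (≤′-step i≤j) = ≤-trans (go i≤j) (a≤a∘suc _)

small-increment : ∀ J {N} (b c : ℕ → ℕ) → 0 < J →
                  (∀ i → b i + c i ≤ c (suc i)) → c J ≤ N → ∃ λ i → i < J × J * b i ≤ N
small-increment J {N} b c J>0 telescope cJ≤N with scan J
  where
  scan : ∀ t → (∃ λ i → i < t × J * b i ≤ N) ⊎ t * suc N ≤ J * c t
  scan zero    = inj₂ z≤n
  scan (suc t) with scan t
  ... | inj₁ (i , i<t , small) = inj₁ (i , m<n⇒m<1+n i<t , small)
  ... | inj₂ grows with J * b t ≤? N
  ...   | yes small = inj₁ (t , n<1+n t , small)
  ...   | no  large = inj₂ (begin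
          suc N + t * suc N     ≤⟨ +-mono-≤ (≰⇒> large) grows ⟩
          J * b t + J * c t     ≡⟨ *-distribˡ-+ J (b t) (c t) ⟨
          J * (b t + c t)       ≤⟨ *-monoʳ-≤ J (telescope t) ⟩
          J * c (suc t)         ∎)
    where open ≤-Reasoning
... | inj₁ found = found
... | inj₂ grows = ⊥-elim (<⇒≱ (*-monoʳ-< J {{>-nonZero J>0}} (n<1+n N))
                                (≤-trans grows (*-monoʳ-≤ J cJ≤N)))

-- Neighbourhoods, trigraphs and contractions

∣tabulate∣ : (b : Fin n → Bool) → ∣ tabulate b ∣ ≡ count (λ x → b x Bool.≟ true)
∣tabulate∣ {zero}  b = refl
∣tabulate∣ {suc n} b with b zero
... | true  = cong suc (∣tabulate∣ (b ∘ suc))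
... | false = ∣tabulate∣ (b ∘ suc)

∣tabulate-does∣ : {P : Fin n → Set} (P? : Decidable P) → ∣ tabulate (does ∘ P?) ∣ ≡ count P?
∣tabulate-does∣ P? =
  trans (∣tabulate∣ (does ∘ P?)) (sum-cong-≗ (λ x → 𝟙-≟true (does (P? x))))
  where
  𝟙-≟true : ∀ b → 𝟙 (does (b Bool.≟ true)) ≡ 𝟙 b
  𝟙-≟true true  = refl
  𝟙-≟true false = refl

does-true : {A : Set} (a? : Dec A) → does a? ≡ true → A
does-true (yes a) _ = a

does-false : {A : Set} (a? : Dec A) → not (does a?) ≡ true → ¬ A
does-false (no ¬a) _ = ¬a

anyFin-true : (g : Fin n → Bool) → anyFin g ≡ true → ∃ λ x → g x ≡ true
anyFin-true {suc n} g eq with g zero in g0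
... | true  = zero , g0
... | false = let x , gx = anyFin-true (g ∘ suc) eq in suc x , gx

∣nbhd∣-≤ : (G : Graph n) {P Q : Fin n → Set} (P? : Decidable P) (Q? : Decidable Q) →
           (∀ {y x} → P y → ¬ P x → adj G y x ≡ true → Q x) →
           ∣ nbhd G (tabulate (does ∘ P?)) ∣ ≤ count Q?
∣nbhd∣-≤ {n} G {P} {Q} P? Q? cover =
  ≤-trans (≤-reflexive (∣tabulate∣ in-nbhdᵇ)) (count-mono (λ x → in-nbhdᵇ x Bool.≟ true) Q? in-nbhd)
  where
  S : Subset n
  S = tabulate (does ∘ P?)
  in-nbhdᵇ : Fin n → Bool
  in-nbhdᵇ x = not (lookup S x) ∧ anyFin (λ y → lookup S y ∧ adj G y x)
  membership : ∀ x → lookup S x ≡ does (P? x)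
  membership = lookup∘tabulate (does ∘ P?)
  in-nbhd : ∀ {x} → in-nbhdᵇ x ≡ true → Q x
  in-nbhd {x} x∈N =
    let y , y∈S∧adj = anyFin-true _ (∧-conicalʳ _ _ x∈N)
        Py  = does-true (P? y) (trans (sym (membership y)) (∧-conicalˡ _ _ y∈S∧adj))
        ¬Px = does-false (P? x) (trans (cong not (sym (membership x))) (∧-conicalˡ _ _ x∈N))
    in cover Py ¬Px (∧-conicalʳ _ _ y∈S∧adj)

graph→trigraph-sym : (G : Graph n) (x y : Fin n) → graph→trigraph G x y ≡ graph→trigraph G y x
graph→trigraph-sym G x y = cong (λ b → if b then black else none) (Graph.sym G x y)

black⇒adj : (G : Graph n) (x y : Fin n) → graph→trigraph G x y ≡ black → adj G x y ≡ true
black⇒adj G x y _  with adj G x y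
black⇒adj G x y _  | true = refl
black⇒adj G x y () | false

adj⇒black : (G : Graph n) (x y : Fin n) → adj G x y ≡ true → graph→trigraph G x y ≡ black
adj⇒black G x y adj≡true rewrite adj≡true = refl

Represents : Graph n → (Fin n → Fin m) → Trigraph m → Set
Represents G f T =
  ∀ x y → f x ≢ f y → T (f x) (f y) ≢ red → T (f x) (f y) ≡ graph→trigraph G x y

merge-not-red : ∀ c d → merge c d ≢ red → merge c d ≡ c × merge c d ≡ d
merge-not-red none  none  _ = refl , refl
merge-not-red black black _ = refl , refl
merge-not-red none  black ≢red = ⊥-elim (≢red refl)
merge-not-red none  red   ≢red = ⊥-elim (≢red refl)
merge-not-red black none  ≢red = ⊥-elim (≢red refl)
merge-not-red black red   ≢red = ⊥-elim (≢red refl)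
merge-not-red red   _     ≢red = ⊥-elim (≢red refl)

-- The vertex map of contract T u v u≢v: v is merged into u, and V(T) ∖ {v} is Fin n via punchIn v.
module Collapse {n : ℕ} (u v : Fin (suc n)) (u≢v : u ≢ v) where

  collapse : Fin (suc n) → Fin n
  collapse w with w ≟ v
  ... | yes _   = punchOut (u≢v ∘ sym)
  ... | no  w≢v = punchOut (w≢v ∘ sym)

  punchIn-collapse-v : punchIn v (collapse v) ≡ u
  punchIn-collapse-v with v ≟ v
  ... | yes _   = punchIn-punchOut _
  ... | no  v≢v = ⊥-elim (v≢v refl)

  punchIn-collapse : ∀ {w} → w ≢ v → punchIn v (collapse w) ≡ w
  punchIn-collapse {w} w≢v with w ≟ v
  ... | yes w≡v = ⊥-elim (w≢v w≡v)
  ... | no  _   = punchIn-punchOut _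

  collapse-to-u : ∀ {w} → punchIn v (collapse w) ≡ u → w ≡ u ⊎ w ≡ v
  collapse-to-u {w} eq = case w ≟ v of λ where
    (yes w≡v) → inj₂ w≡v
    (no  w≢v) → inj₁ (trans (sym (punchIn-collapse w≢v)) eq)

  collapse-not-to-u : ∀ {w} → punchIn v (collapse w) ≢ u → punchIn v (collapse w) ≡ w
  collapse-not-to-u {w} neq = case w ≟ v of λ where
    (yes refl) → ⊥-elim (neq punchIn-collapse-v)
    (no  w≢v)  → punchIn-collapse w≢v

  merged-colour : (T : Trigraph (suc n)) {w y z : Fin (suc n)} → w ≡ u ⊎ w ≡ v → y ≡ z →
                  merge (T u y) (T v y) ≢ red → merge (T u y) (T v y) ≡ T w z
  merged-colour T (inj₁ refl) refl ≢red = proj₁ (merge-not-red _ _ ≢red)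
  merged-colour T (inj₂ refl) refl ≢red = proj₂ (merge-not-red _ _ ≢red)

  contract-collapse : (T : Trigraph (suc n)) (w z : Fin (suc n)) → collapse w ≢ collapse z →
                      let c = contract T u v u≢v (collapse w) (collapse z) in
                      c ≢ red → c ≡ T w z ⊎ c ≡ T z w
  contract-collapse T w z cw≢cz ≢red
    with punchIn v (collapse w) ≟ u | punchIn v (collapse z) ≟ u
  ... | yes w↦u | yes z↦u = ⊥-elim (cw≢cz (punchIn-injective v _ _ (trans w↦u (sym z↦u))))
  ... | yes w↦u | no  z↦z = inj₁ (merged-colour T (collapse-to-u w↦u) (collapse-not-to-u z↦z) ≢red)
  ... | no  w↦w | yes z↦u = inj₂ (merged-colour T (collapse-to-u z↦u) (collapse-not-to-u w↦w) ≢red)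
  ... | no  w↦w | no  z↦z = inj₁ (cong₂ T (collapse-not-to-u w↦w) (collapse-not-to-u z↦z))

  represents-contract : {G : Graph m} {f : Fin m → Fin (suc n)} {T : Trigraph (suc n)} →
                        Represents G f T → Represents G (collapse ∘ f) (contract T u v u≢v)
  represents-contract {G = G} {f} {T} rep x y cfx≢cfy ≢red
    with contract-collapse T (f x) (f y) cfx≢cfy ≢red
  ... | inj₁ eq = trans eq (rep x y fx≢fy (≢red ∘ trans eq))
    where fx≢fy = cfx≢cfy ∘ cong collapse
  ... | inj₂ eq = trans eq (trans (rep y x fy≢fx (≢red ∘ trans eq)) (graph→trigraph-sym G y x))
    where fy≢fx = cfx≢cfy ∘ cong collapse ∘ sym

  fibre-size-collapse : (f : Fin m → Fin (suc n)) (a : Fin n) →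
                        fibre-size (collapse ∘ f) a ≤ fibre-size f (punchIn v a) + fibre-size f v
  fibre-size-collapse f a = ≤-trans
    (count-mono (λ x → collapse (f x) ≟ a) (λ x → f x ≟ punchIn v a ⊎-dec f x ≟ v) in-fibres)
    (count-⊎ (λ x → f x ≟ punchIn v a) (λ x → f x ≟ v))
    where
    in-fibres : ∀ {x} → collapse (f x) ≡ a → f x ≡ punchIn v a ⊎ f x ≡ v
    in-fibres {x} refl = case f x ≟ v of λ where
      (yes fx≡v) → inj₂ fx≡v
      (no  fx≢v) → inj₁ (sym (punchIn-collapse fx≢v))

red? : (c : Colour) → Dec (c ≡ red)
red? none  = no λ ()
red? black = no λ ()
red? red   = yes refl

black? : (c : Colour) → Dec (c ≡ black)
black? none  = no λ ()
black? black = yes refl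
black? red   = no λ ()

BlackEdge : Trigraph m → Fin m → Fin m → Set
BlackEdge T X Y = X ≢ Y × T X Y ≡ black

blackEdge? : (T : Trigraph m) (X Y : Fin m) → Dec (BlackEdge T X Y)
blackEdge? T X Y = ¬? (X ≟ Y) ×-dec black? (T X Y)

-- A black pair of distinct parts is complete bipartite in G, so s vertices of X together with
-- s vertices in parts black to X would span a K_{s,s}.
black-neighbourhood< : {G : Graph n} {f : Fin n → Fin m} {T : Trigraph m} {s : ℕ} →
                       ¬ HasKss s G → Represents G f T → (X : Fin m) → s ≤ fibre-size f X →
                       count (λ x → blackEdge? T X (f x)) < s
black-neighbourhood< {G = G} {f} {T} {s} K-free rep X s≤∣X∣
  with s ≤? count (λ x → blackEdge? T X (f x))
... | no  s≰ = ≰⇒> s≰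
... | yes s≤ =
  let A , A-inj , A⊆X = extract (λ x → f x ≟ X) s≤∣X∣
      B , B-inj , B-black = extract (λ x → blackEdge? T X (f x)) s≤
      complete : ∀ i j → adj G (A i) (B j) ≡ true
      complete i j =
        let X≢fB , XfB-black = B-black j
            fAfB-black = subst (λ a → T a (f (B j)) ≡ black) (sym (A⊆X i)) XfB-black
            fA≢fB = λ eq → X≢fB (trans (sym (A⊆X i)) eq)
            not-red = λ r → black≢red (trans (sym fAfB-black) r)
        in black⇒adj G _ _ (trans (sym (rep (A i) (B j) fA≢fB not-red)) fAfB-black)
  in ⊥-elim (K-free (A , B , A-inj , B-inj , complete))
  where
  black≢red : black ≢ red
  black≢red ()

record Snapshot {N : ℕ} (G : Graph N) (k E : ℕ) : Set where
  field
    {order}    : ℕ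
    T          : Trigraph order
    part       : Fin N → Fin order
    represents : Represents G part T
    bandwidth  : RedBandwidth≤ k T
    parts≤     : ∀ a → fibre-size part a ≤ E + E
    heavy      : Fin order
    E<heavy    : E < fibre-size part heavy

module _ {N : ℕ} (G : Graph N) {k E : ℕ} (E<N : E < N) where

  -- Stop at the first trigraph with a part of more than E vertices: up to then all parts had
  -- at most E vertices, so the contraction that produced it left parts of at most 2E.
  first-heavy-snapshot : ∀ {n} {T : Trigraph (suc n)} → Reduction≤ k T →
                         (f : Fin N → Fin (suc n)) → Represents G f T →
                         (∀ a → fibre-size f a ≤ E + E) → Snapshot G k E
  first-heavy-snapshot (done T bw) f rep f≤ = record
    { T = T ; part = f ; represents = rep ; bandwidth = bw ; parts≤ = f≤
    ; heavy = zero ; E<heavy = subst (E <_) (sym (count-all (λ x → f x ≟ zero) only-zero)) E<N }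
    where
    only-zero : ∀ x → f x ≡ zero
    only-zero x with f x
    ... | zero = refl
  first-heavy-snapshot (step T u v u≢v bw rest) f rep f≤ with any? (λ a → E <? fibre-size f a)
  ... | yes (a , E<a) = record
    { T = T ; part = f ; represents = rep ; bandwidth = bw ; parts≤ = f≤
    ; heavy = a ; E<heavy = E<a }
  ... | no ∄heavy =
    first-heavy-snapshot rest (collapse ∘ f) (represents-contract {G = G} rep) collapsed≤
    where
    open Collapse u v u≢v
    light : ∀ a → fibre-size f a ≤ E
    light a = ≮⇒≥ (∄heavy ∘ (a ,_))
    collapsed≤ : ∀ a → fibre-size (collapse ∘ f) a ≤ E + E
    collapsed≤ a = ≤-trans (fibre-size-collapse f a) (+-mono-≤ (light (punchIn v a)) (light v))

-- Counting around a prefix of the bandwidth ordering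

module SnapshotBounds {N s k E : ℕ} {G : Graph N} (K-free : ¬ HasKss s G) (S : Snapshot G k E) where
  open Snapshot S public

  size : Fin order → ℕ
  size = fibre-size part

  pos : Fin order → ℕ
  pos a = toℕ (proj₁ bandwidth ⟨$⟩ʳ a)

  pos-injective : Injective _≡_ _≡_ pos
  pos-injective = Injection.injective (↔⇒↣ (proj₁ bandwidth)) ∘ toℕ-injective

  pos<order : ∀ a → pos a < order
  pos<order a = toℕ<n (proj₁ bandwidth ⟨$⟩ʳ a)

  RedEdge : Fin order → Fin order → Set
  RedEdge X Y = X ≢ Y × T X Y ≡ red

  redEdge? : ∀ X Y → Dec (RedEdge X Y)
  redEdge? X Y = ¬? (X ≟ Y) ×-dec red? (T X Y)

  red⇒near : ∀ {X Y} → RedEdge X Y → pos Y ≤ pos X + k × pos X ≤ pos Y + k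
  red⇒near {X} {Y} (X≢Y , XY-red) =
    let dist≤k = proj₂ bandwidth _ _ X≢Y XY-red in
    ≤-trans (m≤n+∣n-m∣ (pos Y) (pos X)) (+-monoʳ-≤ (pos X) dist≤k) ,
    ≤-trans (m≤n+∣m-n∣ (pos X) (pos Y)) (+-monoʳ-≤ (pos Y) dist≤k)

  red-degree≤ : ∀ X → count (redEdge? X) ≤ suc (2 * k)
  red-degree≤ X = count-interval (redEdge? X) pos pos-injective (pos X ∸ k) (suc (2 * k)) in-range
    where
    in-range : ∀ {Y} → RedEdge X Y → pos X ∸ k ≤ pos Y × pos Y < pos X ∸ k + suc (2 * k)
    in-range XY-red =
      let Y≤X+k , X≤Y+k = red⇒near XY-red in
      m≤n+o⇒m∸n≤o (pos X) k (subst (pos X ≤_) (+-comm _ k) X≤Y+k) ,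
      (begin-strict
        pos _                        ≤⟨ Y≤X+k ⟩
        pos X + k                    ≤⟨ +-monoˡ-≤ k (m≤n+m∸n (pos X) k) ⟩
        k + (pos X ∸ k) + k          <⟨ n<1+n _ ⟩
        suc (k + (pos X ∸ k) + k)    ≡⟨ cong suc (rearrange (pos X ∸ k) k) ⟩
        suc (pos X ∸ k + 2 * k)      ≡⟨ +-suc (pos X ∸ k) (2 * k) ⟨
        pos X ∸ k + suc (2 * k)      ∎)
      where
      open ≤-Reasoning
      rearrange : ∀ a b → b + a + b ≡ a + 2 * b
      rearrange = solve-∀

  InWindow : ℕ → Fin order → Set
  InWindow j a = j ≤ pos a × pos a < j + k

  inWindow? : ∀ j a → Dec (InWindow j a)
  inWindow? j a = j ≤? pos a ×-dec pos a <? j + k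

  window-mass : ℕ → ℕ
  window-mass j = count (inWindow? j ∘ part)

  window-mass≤ : ∀ j → window-mass j ≤ (E + E) * k
  window-mass≤ j = ≤-trans (count-∘-≤ (inWindow? j) part (λ a _ → parts≤ a))
    (*-monoʳ-≤ (E + E) (count-interval (inWindow? j) pos pos-injective j k (λ a∈W → a∈W)))

  window-mass-beyond : ∀ {j} → order ≤ j → window-mass j ≡ 0
  window-mass-beyond order≤j = count-none (inWindow? _ ∘ part) λ x (j≤ , _) →
    <⇒≱ (<-≤-trans (pos<order (part x)) order≤j) j≤

  Band : ℕ → ℕ → Fin order → Set
  Band Lt Lb a = Lt ≤ size a × size a < Lb

  band? : ∀ Lt Lb a → Dec (Band Lt Lb a)
  band? Lt Lb a = Lt ≤? size a ×-dec size a <? Lb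

  below? : ∀ L x → Dec (size (part x) < L)
  below? L x = size (part x) <? L

  band+below≤below : ∀ {Lt Lb} → Lt ≤ Lb →
    count (band? Lt Lb ∘ part) + count (below? Lt) ≤ count (below? Lb)
  band+below≤below {Lt} {Lb} Lt≤Lb = ≤-trans
    (count-disjoint-⊎ (band? Lt Lb ∘ part) (below? Lt) (λ (Lt≤ , _) → ≤⇒≯ Lt≤))
    (count-mono (λ x → band? Lt Lb (part x) ⊎-dec below? Lt x) (below? Lb)
      [ proj₂ , (λ <Lt → <-≤-trans <Lt Lt≤Lb) ])

  module Prefixes (Lt Lb : ℕ) (s≤Lb : s ≤ Lb) where

    InPrefix : ℕ → Fin order → Set
    InPrefix j a = Lb ≤ size a × pos a < j

    inPrefix? : ∀ j a → Dec (InPrefix j a)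
    inPrefix? j a = Lb ≤? size a ×-dec pos a <? j

    InBand : Fin order → Set
    InBand = Band Lt Lb

    inBand? : ∀ a → Dec (InBand a)
    inBand? = band? Lt Lb

    Attached : Fin order → Fin order → Set
    Attached X Y = (RedEdge X Y × size Y < Lt) ⊎ BlackEdge T X Y

    attached? : ∀ X Y → Dec (Attached X Y)
    attached? X Y = (redEdge? X Y ×-dec size Y <? Lt) ⊎-dec blackEdge? T X Y

    AttachedToPrefix : ℕ → Fin order → Set
    AttachedToPrefix j Y = ∃ λ X → InPrefix j X × Attached X Y

    attachedToPrefix? : ∀ j Y → Dec (AttachedToPrefix j Y)
    attachedToPrefix? j Y = any? (λ X → inPrefix? j X ×-dec attached? X Y)

    prefix : ℕ → Subset N
    prefix j = tabulate (does ∘ inPrefix? j ∘ part)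

    mass : ℕ → ℕ
    mass j = count (inPrefix? j ∘ part)

    band-mass : ℕ
    band-mass = count (inBand? ∘ part)

    attached-mass : ℕ → ℕ
    attached-mass j = count (attachedToPrefix? j ∘ part)

    boundary-covered : ∀ j {y x} → InPrefix j (part y) → ¬ InPrefix j (part x) →
                       adj G y x ≡ true →
                       InWindow j (part x) ⊎ InBand (part x) ⊎ AttachedToPrefix j (part x)
    boundary-covered j {y} {x} X∈P Y∉P adj-yx = by-colour (red? (T X Y))
      where
      X = part y
      Y = part x
      Covered = InWindow j Y ⊎ InBand Y ⊎ AttachedToPrefix j Y
      X≢Y : X ≢ Y
      X≢Y eq = Y∉P (subst (InPrefix j) eq X∈P)
      attached : Attached X Y → Covered
      attached XY = inj₂ (inj₂ (X , X∈P , XY))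
      by-colour : Dec (T X Y ≡ red) → Covered
      by-colour (no ≢red) =
        attached (inj₂ (X≢Y , trans (represents y x X≢Y ≢red) (adj⇒black G y x adj-yx)))
      by-colour (yes XY-red) = by-size (size Y <? Lt) (size Y <? Lb)
        where
        by-size : Dec (size Y < Lt) → Dec (size Y < Lb) → Covered
        by-size (yes tiny) _           = attached (inj₁ ((X≢Y , XY-red) , tiny))
        by-size (no ¬tiny) (yes small) = inj₂ (inj₁ (≮⇒≥ ¬tiny , small))
        by-size (no _)     (no ¬small) =
          inj₁ (≮⇒≥ (Y∉P ∘ (≮⇒≥ ¬small ,_)) ,
                ≤-<-trans (proj₁ (red⇒near (X≢Y , XY-red))) (+-monoˡ-< k (proj₂ X∈P)))

    ∣∂prefix∣≤ : ∀ j → ∣ nbhd G (prefix j) ∣ ≤ window-mass j + (band-mass + attached-mass j)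
    ∣∂prefix∣≤ j = begin
      ∣ nbhd G (prefix j) ∣
        ≤⟨ ∣nbhd∣-≤ G (inPrefix? j ∘ part) covered? (boundary-covered j) ⟩
      count covered?
        ≤⟨ count-⊎ (inWindow? j ∘ part) band-or-attached? ⟩
      window-mass j + count band-or-attached?
        ≤⟨ +-monoʳ-≤ _ (count-⊎ (inBand? ∘ part) (attachedToPrefix? j ∘ part)) ⟩
      window-mass j + (band-mass + attached-mass j)  ∎
      where
      open ≤-Reasoning
      band-or-attached? : ∀ x → Dec (InBand (part x) ⊎ AttachedToPrefix j (part x))
      band-or-attached? x = inBand? (part x) ⊎-dec attachedToPrefix? j (part x)
      covered? : ∀ x → Dec (InWindow j (part x) ⊎ InBand (part x) ⊎ AttachedToPrefix j (part x))
      covered? x = inWindow? j (part x) ⊎-dec band-or-attached? x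

    attached-mass-of : ∀ X → Lb ≤ size X → count (attached? X ∘ part) ≤ suc (2 * k) * Lt + s
    attached-mass-of X Lb≤X = begin
      count (attached? X ∘ part)
        ≤⟨ count-⊎ (tinyRed? ∘ part) (blackEdge? T X ∘ part) ⟩
      count (tinyRed? ∘ part) + count (blackEdge? T X ∘ part)
        ≤⟨ +-mono-≤ tiny-red-mass (<⇒≤ black-mass) ⟩
      suc (2 * k) * Lt + s  ∎
      where
      open ≤-Reasoning
      black-mass : count (blackEdge? T X ∘ part) < s
      black-mass = black-neighbourhood< {G = G} {f = part} {T = T} K-free represents X
                                        (≤-trans s≤Lb Lb≤X)
      tinyRed? : ∀ Y → Dec (RedEdge X Y × size Y < Lt)
      tinyRed? Y = redEdge? X Y ×-dec size Y <? Lt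
      tiny-red-mass : count (tinyRed? ∘ part) ≤ suc (2 * k) * Lt
      tiny-red-mass = begin
        count (tinyRed? ∘ part)  ≤⟨ count-∘-≤ tinyRed? part (λ _ (_ , tiny) → <⇒≤ tiny) ⟩
        Lt * count tinyRed?      ≤⟨ *-monoʳ-≤ Lt (count-mono tinyRed? (redEdge? X) proj₁) ⟩
        Lt * count (redEdge? X)  ≤⟨ *-monoʳ-≤ Lt (red-degree≤ X) ⟩
        Lt * suc (2 * k)         ≡⟨ *-comm Lt _ ⟩
        suc (2 * k) * Lt         ∎

    attached-mass≤ : ∀ j → attached-mass j ≤ (suc (2 * k) * Lt + s) * count (inPrefix? j)
    attached-mass≤ j = begin
      attached-mass j
        ≤⟨ count-∃ (λ X x → inPrefix? j X ×-dec attached? X (part x)) ⟩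
      ∑[ X < order ] count (λ x → inPrefix? j X ×-dec attached? X (part x))
        ≡⟨ sum-cong-≗ (λ X → count-const-× (inPrefix? j X) (attached? X ∘ part)) ⟩
      ∑[ X < order ] (𝟙 (does (inPrefix? j X)) * count (attached? X ∘ part))
        ≤⟨ ∑-𝟙*-≤ (inPrefix? j) _ _ (λ X (Lb≤X , _) → attached-mass-of X Lb≤X) ⟩
      (suc (2 * k) * Lt + s) * count (inPrefix? j)  ∎
      where open ≤-Reasoning

    prefix-parts≤ : ∀ j → Lb * count (inPrefix? j) ≤ mass j
    prefix-parts≤ j = count-∘-≥ (inPrefix? j) part (λ _ → proj₁)

    mass-zero : mass 0 ≡ 0
    mass-zero = count-none (inPrefix? 0 ∘ part) (λ _ → n≮0 ∘ proj₂)

    mass-suc : ∀ j → mass (suc j) ≤ mass j + (E + E)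
    mass-suc j = begin
      mass (suc j)                     ≤⟨ count-mono (inPrefix? (suc j) ∘ part) old-or-new? split ⟩
      count old-or-new?                ≤⟨ count-⊎ (inPrefix? j ∘ part) (atPos? ∘ part) ⟩
      mass j + count (atPos? ∘ part)   ≤⟨ +-monoʳ-≤ (mass j) new-mass ⟩
      mass j + (E + E) * 1             ≡⟨ cong (mass j +_) (*-identityʳ (E + E)) ⟩
      mass j + (E + E)                 ∎
      where
      open ≤-Reasoning
      atPos? : ∀ a → Dec (pos a ≡ j)
      atPos? a = pos a ℕ.≟ j
      old-or-new? : ∀ x → Dec (InPrefix j (part x) ⊎ pos (part x) ≡ j)
      old-or-new? x = inPrefix? j (part x) ⊎-dec atPos? (part x)
      split : ∀ {x} → InPrefix (suc j) (part x) → InPrefix j (part x) ⊎ pos (part x) ≡ j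
      split (big , <suc-j) with m≤n⇒m<n∨m≡n (s≤s⁻¹ <suc-j)
      ... | inj₁ <j  = inj₁ (big , <j)
      ... | inj₂ ≡j  = inj₂ ≡j
      unique-at-pos : count atPos? ≤ 1
      unique-at-pos = count-interval atPos? pos pos-injective j 1
        (λ ≡j → ≤-reflexive (sym ≡j) , ≤-reflexive (trans (cong suc ≡j) (+-comm 1 j)))
      new-mass : count (atPos? ∘ part) ≤ (E + E) * 1
      new-mass = ≤-trans (count-∘-≤ atPos? part (λ a _ → parts≤ a)) (*-monoʳ-≤ (E + E) unique-at-pos)

    heavy-mass : Lb ≤ E → E < mass order
    heavy-mass Lb≤E = <-≤-trans E<heavy
      (count-mono (λ x → part x ≟ heavy) (inPrefix? order ∘ part)
        (λ { refl → ≤-trans Lb≤E (<⇒≤ E<heavy) , pos<order heavy }))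

-- The expander argument

threshold : (q c s : ℕ) → ℕ → ℕ
threshold q c s zero    = 1
threshold q c s (suc i) = 3 * q * (c * threshold q c s i + s)

module ExpanderArgument {s p q k : ℕ} (p>0 : 0 < p) (q>0 : 0 < q) where

  c : ℕ
  c = suc (2 * k)

  L : ℕ → ℕ
  L = threshold q c s

  D : ℕ
  D = 6 + 12 * q * k

  J : ℕ
  J = 6 * q * D

  x≤a*x : ∀ x {a} → 0 < a → x ≤ a * x
  x≤a*x x {a} a>0 = m≤n*m x a {{>-nonZero a>0}}

  3q>0 : 0 < 3 * q
  3q>0 = ≤-trans q>0 (m≤n*m q 3)

  J>0 : 0 < J
  J>0 = ≤-trans (≤-trans q>0 (m≤n*m q 6)) (m≤m*n (6 * q) D)

  L-step : ∀ i → L i ≤ L (suc i)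
  L-step i = ≤-trans (m≤n*m (L i) c) (≤-trans (m≤m+n (c * L i) s) (x≤a*x _ 3q>0))

  L-mono : ∀ {i j} → i ≤ j → L i ≤ L j
  L-mono = ≤-step-mono L L-step

  s≤L-suc : ∀ i → s ≤ L (suc i)
  s≤L-suc i = ≤-trans (m≤n+m s (c * L i)) (x≤a*x _ 3q>0)

  module InSnapshot {N : ℕ} {G : Graph N} (expander : IsExpander s p q G)
                    {E : ℕ} (S : Snapshot G k E)
                    (DE≤N : D * E ≤ N) (N<2DE : N < 2 * D * E) (LJ≤E : L J ≤ E) where

    open SnapshotBounds (proj₁ expander) S

    quiet-band : ∃ λ i → i < J × J * count (band? (L i) (L (suc i)) ∘ part) ≤ N
    quiet-band = small-increment J (λ i → count (band? (L i) (L (suc i)) ∘ part))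
      (λ i → count (below? (L i))) J>0 (λ i → band+below≤below (L-step i)) (count≤n (below? (L J)))

    module AtScale (i : ℕ) (i<J : i < J)
                   (quiet : J * count (band? (L i) (L (suc i)) ∘ part) ≤ N) where

      open Prefixes (L i) (L (suc i)) (s≤L-suc i)

      Lb≤E : L (suc i) ≤ E
      Lb≤E = ≤-trans (L-mono i<J) LJ≤E

      band-small : 3 * q * band-mass < E
      band-small = *-cancelˡ-< (2 * D) _ _ (begin-strict
        2 * D * (3 * q * B)  ≡⟨ regroup q D B ⟩
        J * B                ≤⟨ quiet ⟩
        N                    <⟨ N<2DE ⟩
        2 * D * E            ∎)
        where
        open ≤-Reasoning
        B = band-mass
        regroup : ∀ q D B → 2 * D * (3 * q * B) ≡ 6 * q * D * B
        regroup = solve-∀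

      attached-small : ∀ j → 3 * q * attached-mass j ≤ mass j
      attached-small j = begin
        3 * q * attached-mass j                        ≤⟨ *-monoʳ-≤ (3 * q) (attached-mass≤ j) ⟩
        3 * q * ((c * L i + s) * count (inPrefix? j))  ≡⟨ *-assoc (3 * q) _ _ ⟨
        L (suc i) * count (inPrefix? j)                ≤⟨ prefix-parts≤ j ⟩
        mass j                                         ∎
        where open ≤-Reasoning

      prefix-expands : ∀ j → 2 * mass j ≤ N → p * mass j ≤ q * ∣ nbhd G (prefix j) ∣
      prefix-expands j half = subst (λ size → p * size ≤ q * ∣ nbhd G (prefix j) ∣) ∣prefix∣
        (proj₂ expander (prefix j) (subst (λ size → 2 * size ≤ N) (sym ∣prefix∣) half))
        where ∣prefix∣ = ∣tabulate-does∣ (inPrefix? j ∘ part)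

      no-balanced-prefix : ∀ j → 2 * mass j ≤ N → 3 * q * window-mass j ≤ mass j → E ≤ mass j → ⊥
      no-balanced-prefix j half window-small E≤F = <-irrefl refl (begin-strict
        3 * (p * F)                          ≤⟨ *-monoʳ-≤ 3 (prefix-expands j half) ⟩
        3 * (q * ∣ nbhd G (prefix j) ∣)      ≤⟨ *-monoʳ-≤ 3 (*-monoʳ-≤ q (∣∂prefix∣≤ j)) ⟩
        3 * (q * (W + (B + A)))              ≡⟨ distribute q W B A ⟩
        3 * q * W + (3 * q * B + 3 * q * A)  <⟨ +-mono-≤-< window-small
                                                 (+-mono-<-≤ (<-≤-trans band-small E≤F) (attached-small j)) ⟩
        F + (F + F)                          ≡⟨ triple F ⟩
        3 * F                                ≤⟨ *-monoʳ-≤ 3 (x≤a*x F p>0) ⟩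
        3 * (p * F)                          ∎)
        where
        open ≤-Reasoning
        F = mass j
        W = window-mass j
        B = band-mass
        A = attached-mass j
        distribute : ∀ q W B A → 3 * (q * (W + (B + A))) ≡ 3 * q * W + (3 * q * B + 3 * q * A)
        distribute = solve-∀
        triple : ∀ F → F + (F + F) ≡ 3 * F
        triple = solve-∀

      balanced-prefix : ∃ λ j → 2 * mass j ≤ N × 3 * q * window-mass j ≤ mass j × E ≤ mass j
      balanced-prefix with 2 * mass order ≤? N
      ... | yes half = order , half , window-empty , <⇒≤ (heavy-mass Lb≤E)
        where
        window-empty : 3 * q * window-mass order ≤ mass order
        window-empty rewrite window-mass-beyond {order} ≤-refl | *-zeroʳ (3 * q) = z≤n
      ... | no ¬half =
        let j , half , overflow = crossing (λ j → 2 * mass j) {N} start order (≰⇒> ¬half)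
            E+budget≤F = <⇒≤ (budget-fits (mass j) (<-≤-trans overflow (*-monoʳ-≤ 2 (mass-suc j))))
        in j , half , ≤-trans (*-monoʳ-≤ (3 * q) (window-mass≤ j)) (m+n≤o⇒n≤o E E+budget≤F) ,
           m+n≤o⇒m≤o E E+budget≤F
        where
        start : 2 * mass 0 ≤ N
        start rewrite mass-zero = z≤n
        budget-fits : ∀ F → N < 2 * (F + (E + E)) → E + 3 * q * ((E + E) * k) < F
        budget-fits F N<2[F+2E] = *-cancelˡ-< 2 _ _ (+-cancelˡ-< (4 * E) _ _ (begin-strict
          4 * E + 2 * (E + 3 * q * ((E + E) * k))  ≡⟨ expand-D q k E ⟩
          D * E                                    ≤⟨ DE≤N ⟩
          N                                        <⟨ N<2[F+2E] ⟩
          2 * (F + (E + E))                        ≡⟨ expand-2F F E ⟩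
          4 * E + 2 * F                            ∎))
          where
          open ≤-Reasoning
          expand-D : ∀ q k E → 4 * E + 2 * (E + 3 * q * ((E + E) * k)) ≡ (6 + 12 * q * k) * E
          expand-D = solve-∀
          expand-2F : ∀ F E → 2 * (F + (E + E)) ≡ 4 * E + 2 * F
          expand-2F = solve-∀

    absurd : ⊥
    absurd =
      let i , i<J , quiet = quiet-band
          j , half , window-small , E≤F = AtScale.balanced-prefix i i<J quiet
      in AtScale.no-balanced-prefix i i<J quiet j half window-small E≤F

  expander⇒¬RedBW≤ : ∀ {n} (G : Graph (suc n)) → IsExpander s p q G → D * L J < suc n →
                     ¬ RedBW≤ k G
  expander⇒¬RedBW≤ {n} G expander DLJ<N reduction =
    let t , DE≤N , N<D[1+E] = crossing (λ t → D * (t + L J)) {N} (<⇒≤ DLJ<N) N N<D[N+LJ]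
    in refute (t + L J) (m≤n+m (L J) t) DE≤N N<D[1+E]
    where
    N = suc n

    LJ>0 : 0 < L J
    LJ>0 = L-mono {0} {J} z≤n

    N<D[N+LJ] : N < D * (N + L J)
    N<D[N+LJ] = <-≤-trans (m<m+n N LJ>0) (m≤n*m (N + L J) D)

    refute : ∀ E → L J ≤ E → D * E ≤ N → N < D * suc E → ⊥
    refute E LJ≤E DE≤N N<D[1+E] = InSnapshot.absurd expander snapshot DE≤N N<2DE LJ≤E
      where
      E>0 : 0 < E
      E>0 = <-≤-trans LJ>0 LJ≤E

      E<N : E < N
      E<N = <-≤-trans (subst (E <_) (*-comm E D) (m<m*n E D {{>-nonZero E>0}} (s≤s (s≤s z≤n))))
                      DE≤N

      N<2DE : N < 2 * D * E
      N<2DE = <-≤-trans N<D[1+E] (begin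
        D * suc E      ≡⟨ *-suc D E ⟩
        D + D * E      ≤⟨ +-monoˡ-≤ (D * E) (m≤m*n D E {{>-nonZero E>0}}) ⟩
        D * E + D * E  ≡⟨ double D E ⟩
        2 * D * E      ∎)
        where
        open ≤-Reasoning
        double : ∀ D E → D * E + D * E ≡ 2 * D * E
        double = solve-∀

      singletons : ∀ a → fibre-size id a ≤ E + E
      singletons a = ≤-trans
        (count-≤-injection (λ x → x ≟ a) (λ _ _ → zero) (λ { refl refl _ → refl }))
        (≤-trans E>0 (m≤m+n E E))

      snapshot : Snapshot G k E
      snapshot = first-heavy-snapshot G E<N reduction id (λ _ _ _ _ → refl) singletons

theorem31 : (s p q : ℕ) → 0 < p → 0 < q →
    (𝒢 : (n : ℕ) → Graph n → Set) →
    (∀ n (G : Graph n) → 𝒢 n G → IsExpander s p q G) →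
    (∀ m → Σ ℕ λ n → Σ (Graph n) λ G → m ≤ n × 𝒢 n G) →
    ∀ k → Σ ℕ λ n → Σ (Graph (suc n)) λ G → 𝒢 (suc n) G × ¬ RedBW≤ k G
theorem31 s p q p>0 q>0 𝒢 expanders infinite k = case infinite (suc (D * L J)) of λ where
    (suc n , G , large , G∈𝒢) → n , G , G∈𝒢 , expander⇒¬RedBW≤ G (expanders (suc n) G G∈𝒢) large
    (zero  , _ , ()    , _)
  where open ExpanderArgument {s} {p} {q} {k} p>0 q>0
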